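{- For every positive integer $n$ and every integer $k$ with $n \le 2^k$, \[ B(n) \;=\; \frac{n k}{2} - 2^{k-1}\, \tilde{F}\!\left(\frac{n}{2^k}\right). \]
   Context: For a real number $x$, $\mathrm{Zigzag}(x) = \min\left(x - \lfloor x \rfloor,\ \lceil x \rceil - x\right)$. The function $\tilde{F}:\mathbb{R}\to\mathbb{R}$ is $\tilde{F}(x) = \sum_{i=0}^{\infty} 2^{ -i}\, \mathrm{Zigzag}(2^i x)$. $B$ is the function on positive integers defined by $B(1) = 0$ and, for $n \ge 2$, $B(n) = \lfloor n/2 \rfloor + B(\lfloor n/2 \rfloor) + B(\lceil n/2 \rceil)$. -}

module Defs where

open import Data.Nat as ℕ using (ℕ; zero; suc)
open import Data.Integer using (ℤ; +_)
open import Data.Rational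
open import Data.Product using (∃-syntax)

-- B(1) = 0 and B(n) = ⌊n/2⌋ + B(⌊n/2⌋) + B(⌈n/2⌉) for n ≥ 2.
-- Implemented with a fuel argument; fuel n suffices since both halves of
-- n ≥ 2 are ≤ n - 1. (B 0 = 0 is a dummy value, never used.)
B-fuel : ℕ → ℕ → ℕ
B-fuel zero    n = 0
B-fuel (suc f) 0 = 0
B-fuel (suc f) 1 = 0
B-fuel (suc f) n@(suc (suc _)) =
  ℕ.⌊ n /2⌋ ℕ.+ B-fuel f ℕ.⌊ n /2⌋ ℕ.+ B-fuel f ℕ.⌈ n /2⌉

B : ℕ → ℕ
B n = B-fuel n n

ℤtoℚ : ℤ → ℚ
ℤtoℚ z = z / 1

ℕtoℚ : ℕ → ℚ
ℕtoℚ n = (+ n) / 1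

pow2 : ℕ → ℚ
pow2 zero    = 1ℚ
pow2 (suc i) = (ℕtoℚ 2) * pow2 i

halfPow : ℕ → ℚ
halfPow zero    = 1ℚ
halfPow (suc i) = ½ * halfPow i

zigzag : ℚ → ℚ
zigzag x = (x - ℤtoℚ (floor x)) ⊓ (ℤtoℚ (ceiling x) - x)

Fterm : ℚ → ℕ → ℚ
Fterm x i = halfPow i * zigzag (pow2 i * x)

Fpartial : ℚ → ℕ → ℚ
Fpartial x zero    = 0ℚ
Fpartial x (suc N) = Fpartial x N + Fterm x N

-- "F̃(x) = L": the series Σ_i 2^{-i} Zigzag(2^i x) converges to L
-- (ε-N definition; partial sums and L are rational, so rational ε suffice).
FtildeIs : ℚ → ℚ → Set
FtildeIs x L = ∀ (ε : ℚ) → 0ℚ < ε →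
  ∃[ M ] (∀ (N : ℕ) → M ℕ.≤ N → ∣ Fpartial x N - L ∣ < ε)

-- Write d_j(n) (dyadicDist j n) for the distance from n to the nearest multiple of 2^j, so
-- that 2^j · Zigzag(n / 2^j) = d_j(n). For x = n / 2^k the terms of the series with i ≥ k
-- vanish, hence 2^k · F̃(n / 2^k) = d_1(n) + … + d_k(n). The distances satisfy
-- d_{j+1}(n) = d_j(⌊n/2⌋) + d_j(⌈n/2⌉) for j ≥ 1 and 2⌊n/2⌋ + d_1(n) = n, so
-- 2B(n) + Σ_{j ≤ k} d_j(n) obeys the recurrence of n·k, and induction on k gives
-- 2B(n) + Σ_{j ≤ k} d_j(n) = nk whenever 1 ≤ n ≤ 2^k.
module Submission where

open import Defs

module Natural where
  open import Function using (_∘_)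
  open import Data.Nat
  open import Data.Nat.Properties
  open import Data.Nat.DivMod
  open import Data.Nat.Divisibility using (_∣_; divides)
  open import Data.Nat.Solver using (module +-*-Solver)
  open import Data.Product using (_×_; _,_)
  open import Data.Sum using (_⊎_; inj₁; inj₂)
  open import Relation.Binary.Definitions using (tri<; tri≈; tri>)
  open import Relation.Binary.PropositionalEquality
  open import Relation.Nullary using (contradiction)
  open +-*-Solver
  open ≡-Reasoning

  even⊎odd : ∀ n → (n ≡ 2 * ⌊ n /2⌋ × ⌈ n /2⌉ ≡ ⌊ n /2⌋) ⊎ (n ≡ suc (2 * ⌊ n /2⌋) × ⌈ n /2⌉ ≡ suc ⌊ n /2⌋)
  even⊎odd 0 = inj₁ (refl , refl)
  even⊎odd 1 = inj₂ (refl , refl)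
  even⊎odd (suc (suc n)) with even⊎odd n
  ... | inj₁ (e , c) = inj₁ (trans (cong (suc ∘ suc) e) (sym (*-suc 2 ⌊ n /2⌋)) , cong suc c)
  ... | inj₂ (e , c) = inj₂ (trans (cong (suc ∘ suc) e) (cong suc (sym (*-suc 2 ⌊ n /2⌋))) , cong suc c)

  suc[2r]⊓suc[2s]≡r⊓suc[s]+suc[r]⊓s : ∀ {r s} → r ≢ s → suc (2 * r) ⊓ suc (2 * s) ≡ r ⊓ suc s + suc r ⊓ s
  suc[2r]⊓suc[2s]≡r⊓suc[s]+suc[r]⊓s {r} {s} r≢s with <-cmp r s
  ... | tri< r<s _ _ = begin
    suc (2 * r) ⊓ suc (2 * s) ≡⟨ m≤n⇒m⊓n≡m (s≤s (*-monoʳ-≤ 2 (<⇒≤ r<s))) ⟩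
    suc (2 * r)               ≡⟨ solve 1 (λ r → con 1 :+ con 2 :* r := r :+ (con 1 :+ r)) refl r ⟩
    r + suc r                 ≡⟨ sym (cong₂ _+_ (m≤n⇒m⊓n≡m (m≤n⇒m≤1+n (<⇒≤ r<s))) (m≤n⇒m⊓n≡m r<s)) ⟩
    r ⊓ suc s + suc r ⊓ s     ∎
  ... | tri≈ _ r≡s _ = contradiction r≡s r≢s
  ... | tri> _ _ s<r = begin
    suc (2 * r) ⊓ suc (2 * s) ≡⟨ m≥n⇒m⊓n≡n (s≤s (*-monoʳ-≤ 2 (<⇒≤ s<r))) ⟩
    suc (2 * s)               ≡⟨ solve 1 (λ s → con 1 :+ con 2 :* s := (con 1 :+ s) :+ s) refl s ⟩
    suc s + s                 ≡⟨ sym (cong₂ _+_ (m≥n⇒m⊓n≡n s<r) (m≥n⇒m⊓n≡n (m≤n⇒m≤1+n (<⇒≤ s<r)))) ⟩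
    r ⊓ suc s + suc r ⊓ s     ∎

  distToMultiple : (m : ℕ) .{{_ : NonZero m}} → ℕ → ℕ
  distToMultiple m n = n % m ⊓ (m ∸ n % m)

  distToMultiple-+* : ∀ m .{{_ : NonZero m}} {r} q → r ≤ m → distToMultiple m (r + q * m) ≡ r ⊓ (m ∸ r)
  distToMultiple-+* m {r} q r≤m with m≤n⇒m<n∨m≡n r≤m
  ... | inj₁ r<m = cong (λ w → w ⊓ (m ∸ w)) (trans ([m+kn]%n≡m%n r q m) (m<n⇒m%n≡m r<m))
  ... | inj₂ refl = begin
    distToMultiple m (m + q * m) ≡⟨ cong (λ w → w ⊓ (m ∸ w)) (trans ([m+kn]%n≡m%n m q m) (n%n≡0 m)) ⟩
    0                            ≡⟨ sym (trans (cong (m ⊓_) (n∸n≡0 m)) (⊓-zeroʳ m)) ⟩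
    m ⊓ (m ∸ m)                  ∎

  module _ (m : ℕ) .{{_ : NonZero m}} where
    private instance
      2*m≢0 : NonZero (2 * m)
      2*m≢0 = m*n≢0 2 m

    distToMultiple-2* : ∀ a → distToMultiple (2 * m) (2 * a) ≡ 2 * distToMultiple m a
    distToMultiple-2* a = begin
      distToMultiple (2 * m) (2 * a)               ≡⟨ cong (distToMultiple (2 * m)) 2a≡ ⟩
      distToMultiple (2 * m) (2 * r + q * (2 * m)) ≡⟨ distToMultiple-+* (2 * m) q (*-monoʳ-≤ 2 (<⇒≤ (m%n<n a m))) ⟩
      2 * r ⊓ (2 * m ∸ 2 * r)                      ≡⟨ cong (2 * r ⊓_) (sym (*-distribˡ-∸ 2 m r)) ⟩
      2 * r ⊓ (2 * (m ∸ r))                        ≡⟨ sym (*-distribˡ-⊓ 2 r (m ∸ r)) ⟩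
      2 * distToMultiple m a                       ∎
      where
      r = a % m
      q = a / m
      2a≡ : 2 * a ≡ 2 * r + q * (2 * m)
      2a≡ = trans (cong (2 *_) (m≡m%n+[m/n]*n a m)) (solve 3 (λ r q m → con 2 :* (r :+ q :* m) := con 2 :* r :+ q :* (con 2 :* m)) refl r q m)

    -- For odd m this fails at a ≡ (m - 1)/2 (mod m): evenness is what rules out r ≡ s below.
    distToMultiple-1+2* : 2 ∣ m → ∀ a → distToMultiple (2 * m) (suc (2 * a)) ≡ distToMultiple m a + distToMultiple m (suc a)
    distToMultiple-1+2* (divides p m≡p*2) a = begin
      distToMultiple (2 * m) (suc (2 * a))
        ≡⟨ cong (distToMultiple (2 * m)) 1+2a≡ ⟩
      distToMultiple (2 * m) (suc (2 * r) + q * (2 * m))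
        ≡⟨ distToMultiple-+* (2 * m) q 1+2r≤2m ⟩
      suc (2 * r) ⊓ (2 * m ∸ suc (2 * r))
        ≡⟨ cong (suc (2 * r) ⊓_) 2m∸[1+2r]≡ ⟩
      suc (2 * r) ⊓ suc (2 * s)
        ≡⟨ suc[2r]⊓suc[2s]≡r⊓suc[s]+suc[r]⊓s r≢s ⟩
      r ⊓ suc s + suc r ⊓ s
        ≡⟨ cong (λ w → r ⊓ w + suc r ⊓ s) (sym m∸r≡) ⟩
      distToMultiple m a + suc r ⊓ (m ∸ suc r)
        ≡⟨ cong (distToMultiple m a +_) (sym (distToMultiple-+* m q r<m)) ⟩
      distToMultiple m a + distToMultiple m (suc r + q * m)
        ≡⟨ cong (λ w → distToMultiple m a + distToMultiple m (suc w)) (sym (m≡m%n+[m/n]*n a m)) ⟩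
      distToMultiple m a + distToMultiple m (suc a) ∎
      where
      r = a % m
      q = a / m
      s = m ∸ suc r
      r<m : r < m
      r<m = m%n<n a m
      r+1+s≡m : r + suc s ≡ m
      r+1+s≡m = trans (+-suc r s) (m+[n∸m]≡n r<m)
      m∸r≡ : m ∸ r ≡ suc s
      m∸r≡ = trans (cong (_∸ r) (sym r+1+s≡m)) (m+n∸m≡n r (suc s))
      2m≡ : 2 * m ≡ suc (2 * r) + suc (2 * s)
      2m≡ = trans (cong (2 *_) (sym r+1+s≡m))
                  (solve 2 (λ r s → con 2 :* (r :+ (con 1 :+ s)) := (con 1 :+ con 2 :* r) :+ (con 1 :+ con 2 :* s)) refl r s)
      2m∸[1+2r]≡ : 2 * m ∸ suc (2 * r) ≡ suc (2 * s)
      2m∸[1+2r]≡ = trans (cong (_∸ suc (2 * r)) 2m≡) (m+n∸m≡n (suc (2 * r)) (suc (2 * s)))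
      1+2r≤2m : suc (2 * r) ≤ 2 * m
      1+2r≤2m = subst (suc (2 * r) ≤_) (sym 2m≡) (m≤m+n (suc (2 * r)) (suc (2 * s)))
      1+2a≡ : suc (2 * a) ≡ suc (2 * r) + q * (2 * m)
      1+2a≡ = cong suc (trans (cong (2 *_) (m≡m%n+[m/n]*n a m))
                              (solve 3 (λ r q m → con 2 :* (r :+ q :* m) := con 2 :* r :+ q :* (con 2 :* m)) refl r q m))
      r≢s : r ≢ s
      r≢s r≡s = even≢odd p r (begin
        2 * p         ≡⟨ trans (*-comm 2 p) (sym m≡p*2) ⟩
        m             ≡⟨ sym r+1+s≡m ⟩
        r + suc s     ≡⟨ cong (λ w → r + suc w) (sym r≡s) ⟩
        r + suc r     ≡⟨ solve 1 (λ r → r :+ (con 1 :+ r) := con 1 :+ con 2 :* r) refl r ⟩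
        suc (2 * r)   ∎)

    distToMultiple-halves : 2 ∣ m → ∀ n → distToMultiple (2 * m) n ≡ distToMultiple m ⌊ n /2⌋ + distToMultiple m ⌈ n /2⌉
    distToMultiple-halves 2∣m n with even⊎odd n
    ... | inj₁ (n≡2a , ⌈n/2⌉≡a) = begin
      distToMultiple (2 * m) n                ≡⟨ cong (distToMultiple (2 * m)) n≡2a ⟩
      distToMultiple (2 * m) (2 * a)          ≡⟨ distToMultiple-2* a ⟩
      2 * distToMultiple m a                  ≡⟨ cong (distToMultiple m a +_) (+-identityʳ (distToMultiple m a)) ⟩
      distToMultiple m a + distToMultiple m a ≡⟨ cong (λ w → distToMultiple m a + distToMultiple m w) (sym ⌈n/2⌉≡a) ⟩
      distToMultiple m a + distToMultiple m ⌈ n /2⌉ ∎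
      where a = ⌊ n /2⌋
    ... | inj₂ (n≡1+2a , ⌈n/2⌉≡1+a) = begin
      distToMultiple (2 * m) n                      ≡⟨ cong (distToMultiple (2 * m)) n≡1+2a ⟩
      distToMultiple (2 * m) (suc (2 * a))          ≡⟨ distToMultiple-1+2* 2∣m a ⟩
      distToMultiple m a + distToMultiple m (suc a) ≡⟨ cong (λ w → distToMultiple m a + distToMultiple m w) (sym ⌈n/2⌉≡1+a) ⟩
      distToMultiple m a + distToMultiple m ⌈ n /2⌉ ∎
      where a = ⌊ n /2⌋

  dyadicDist : ℕ → ℕ → ℕ
  dyadicDist j = distToMultiple (2 ^ j) {{m^n≢0 2 j}}

  dyadicDist-halves : ∀ j n → dyadicDist (suc (suc j)) n ≡ dyadicDist (suc j) ⌊ n /2⌋ + dyadicDist (suc j) ⌈ n /2⌉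
  dyadicDist-halves j = distToMultiple-halves (2 ^ suc j) {{m^n≢0 2 (suc j)}} (divides (2 ^ j) (*-comm 2 (2 ^ j)))

  dyadicDist-one : ∀ j → dyadicDist (suc j) 1 ≡ 1
  dyadicDist-one j = trans (distToMultiple-+* (2 ^ suc j) {{m^n≢0 2 (suc j)}} 0 1≤2^[1+j])
                           (m≤n⇒m⊓n≡m (∸-monoˡ-≤ 1 (*-monoʳ-≤ 2 (m^n>0 2 j))))
    where
    1≤2^[1+j] : 1 ≤ 2 ^ suc j
    1≤2^[1+j] = m^n>0 2 (suc j)

  2*⌊n/2⌋+dyadicDist1≡n : ∀ n → 2 * ⌊ n /2⌋ + dyadicDist 1 n ≡ n
  2*⌊n/2⌋+dyadicDist1≡n n with even⊎odd n
  ... | inj₁ (n≡2a , _) = begin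
    2 * a + dyadicDist 1 n ≡⟨ cong (λ w → 2 * a + dyadicDist 1 w) (trans n≡2a (*-comm 2 a)) ⟩
    2 * a + dyadicDist 1 (0 + a * 2) ≡⟨ cong (2 * a +_) (distToMultiple-+* 2 a z≤n) ⟩
    2 * a + 0              ≡⟨ trans (+-identityʳ (2 * a)) (sym n≡2a) ⟩
    n                      ∎
    where a = ⌊ n /2⌋
  ... | inj₂ (n≡1+2a , _) = begin
    2 * a + dyadicDist 1 n ≡⟨ cong (λ w → 2 * a + dyadicDist 1 w) (trans n≡1+2a (cong suc (*-comm 2 a))) ⟩
    2 * a + dyadicDist 1 (1 + a * 2) ≡⟨ cong (2 * a +_) (distToMultiple-+* 2 a (s≤s z≤n)) ⟩
    2 * a + 1              ≡⟨ trans (+-comm (2 * a) 1) (sym n≡1+2a) ⟩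
    n                      ∎
    where a = ⌊ n /2⌋

  distSum : ℕ → ℕ → ℕ
  distSum n zero    = 0
  distSum n (suc k) = dyadicDist (suc k) n + distSum n k

  distSum-one : ∀ k → distSum 1 k ≡ k
  distSum-one zero    = refl
  distSum-one (suc k) = cong₂ _+_ (dyadicDist-one k) (distSum-one k)

  distSum-halves : ∀ n k → distSum n (suc k) ≡ dyadicDist 1 n + (distSum ⌊ n /2⌋ k + distSum ⌈ n /2⌉ k)
  distSum-halves n zero    = refl
  distSum-halves n (suc k) = begin
    dyadicDist (suc (suc k)) n + distSum n (suc k)
      ≡⟨ cong₂ _+_ (dyadicDist-halves k n) (distSum-halves n k) ⟩
    (da + db) + (d1 + (distSum a k + distSum b k))
      ≡⟨ solve 5 (λ da db d1 sa sb → (da :+ db) :+ (d1 :+ (sa :+ sb)) := d1 :+ ((da :+ sa) :+ (db :+ sb)))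
                 refl da db d1 (distSum a k) (distSum b k) ⟩
    d1 + (distSum a (suc k) + distSum b (suc k)) ∎
    where
    a = ⌊ n /2⌋
    b = ⌈ n /2⌉
    da = dyadicDist (suc k) a
    db = dyadicDist (suc k) b
    d1 = dyadicDist 1 n

  B-fuel-irrelevant : ∀ {f g} n → n ≤ f → n ≤ g → B-fuel f n ≡ B-fuel g n
  B-fuel-irrelevant {zero}  {zero}  zero _ _ = refl
  B-fuel-irrelevant {zero}  {suc g} zero _ _ = refl
  B-fuel-irrelevant {suc f} {zero}  zero _ _ = refl
  B-fuel-irrelevant {suc f} {suc g} zero _ _ = refl
  B-fuel-irrelevant {suc f} {suc g} 1    _ _ = refl
  B-fuel-irrelevant {suc f} {suc g} n@(suc (suc m)) n≤1+f n≤1+g =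
    cong₂ (λ x y → ⌊ n /2⌋ + x + y)
      (B-fuel-irrelevant ⌊ n /2⌋ (≤-trans (⌊n/2⌋≤⌈n/2⌉ n) ⌈n/2⌉≤f) (≤-trans (⌊n/2⌋≤⌈n/2⌉ n) ⌈n/2⌉≤g))
      (B-fuel-irrelevant ⌈ n /2⌉ ⌈n/2⌉≤f ⌈n/2⌉≤g)
    where
    ⌈n/2⌉≤f : ⌈ n /2⌉ ≤ f
    ⌈n/2⌉≤f = s≤s⁻¹ (≤-trans (⌈n/2⌉<n m) n≤1+f)
    ⌈n/2⌉≤g : ⌈ n /2⌉ ≤ g
    ⌈n/2⌉≤g = s≤s⁻¹ (≤-trans (⌈n/2⌉<n m) n≤1+g)

  B-halves : ∀ m → let n = suc (suc m) in B n ≡ ⌊ n /2⌋ + B ⌊ n /2⌋ + B ⌈ n /2⌉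
  B-halves m = cong₂ (λ x y → ⌊ n /2⌋ + x + y)
    (B-fuel-irrelevant ⌊ n /2⌋ (≤-trans (⌊n/2⌋≤⌈n/2⌉ n) ⌈n/2⌉≤1+m) ≤-refl)
    (B-fuel-irrelevant ⌈ n /2⌉ ⌈n/2⌉≤1+m ≤-refl)
    where
    n = suc (suc m)
    ⌈n/2⌉≤1+m : ⌈ n /2⌉ ≤ suc m
    ⌈n/2⌉≤1+m = s≤s⁻¹ (⌈n/2⌉<n m)

  2*B+distSum≡n*k : ∀ k n → 1 ≤ n → n ≤ 2 ^ k → 2 * B n + distSum n k ≡ n * k
  2*B+distSum≡n*k zero    1               _ _            = refl
  2*B+distSum≡n*k zero    (suc (suc m))   _ (s≤s ())
  2*B+distSum≡n*k (suc k) 1               _ _            = trans (distSum-one (suc k)) (sym (*-identityˡ (suc k)))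
  2*B+distSum≡n*k (suc k) n@(suc (suc m)) _ n≤2^[1+k] = begin
    2 * B n + distSum n (suc k)
      ≡⟨ cong₂ (λ x y → 2 * x + y) (B-halves m) (distSum-halves n k) ⟩
    2 * (a + B a + B b) + (d1 + (distSum a k + distSum b k))
      ≡⟨ solve 6 (λ a Ba Bb d1 Sa Sb → con 2 :* (a :+ Ba :+ Bb) :+ (d1 :+ (Sa :+ Sb))
                  := (con 2 :* a :+ d1) :+ (con 2 :* Ba :+ Sa) :+ (con 2 :* Bb :+ Sb))
           refl a (B a) (B b) d1 (distSum a k) (distSum b k) ⟩
    (2 * a + d1) + (2 * B a + distSum a k) + (2 * B b + distSum b k)
      ≡⟨ cong₂ (λ x y → x + y + (2 * B b + distSum b k)) (2*⌊n/2⌋+dyadicDist1≡n n) (2*B+distSum≡n*k k a (s≤s z≤n) a≤2^k) ⟩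
    n + a * k + (2 * B b + distSum b k)
      ≡⟨ cong (n + a * k +_) (2*B+distSum≡n*k k b (s≤s z≤n) b≤2^k) ⟩
    n + a * k + b * k
      ≡⟨ trans (+-assoc n (a * k) (b * k)) (cong (n +_) (sym (*-distribʳ-+ k a b))) ⟩
    n + (a + b) * k
      ≡⟨ cong (λ w → n + w * k) (⌊n/2⌋+⌈n/2⌉≡n n) ⟩
    n + n * k
      ≡⟨ sym (*-suc n k) ⟩
    n * suc k ∎
    where
    a = ⌊ n /2⌋
    b = ⌈ n /2⌉
    d1 = dyadicDist 1 n
    b≤2^k : b ≤ 2 ^ k
    b≤2^k = subst (b ≤_) (trans (cong (λ w → ⌈ 2 ^ k + w /2⌉) (+-identityʳ (2 ^ k))) (sym (n≡⌈n+n/2⌉ (2 ^ k))))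
                  (⌈n/2⌉-mono n≤2^[1+k])
    a≤2^k : a ≤ 2 ^ k
    a≤2^k = ≤-trans (⌊n/2⌋≤⌈n/2⌉ n) b≤2^k

-- Floor, ceiling and zigzag on ℚ

open import Data.Nat as ℕ using (ℕ; zero; suc)
import Data.Nat.Properties as ℕ
import Data.Nat.DivMod as ℕ
open import Data.Integer as ℤ using (ℤ; +_)
import Data.Integer.Properties as ℤ
import Data.Integer.DivMod as ℤ
import Data.Integer.GCD as ℤ
import Data.Nat.Coprimality as Coprimality
open import Data.Rational
open import Data.Rational.Properties
open import Data.Rational.Solver using (module +-*-Solver)
open import Data.Sum using (inj₁; inj₂)
open import Data.Product using (_,_; _×_; ∃-syntax)
open import Relation.Binary.PropositionalEquality
open import Relation.Binary.Definitions using (tri<; tri≈; tri>)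
open import Relation.Nullary using (contradiction)
open Natural
open +-*-Solver
open ≡-Reasoning

↥↧ₙ-injective : ∀ {p q} → ↥ p ≡ ↥ q → ↧ₙ p ≡ ↧ₙ q → p ≡ q
↥↧ₙ-injective {mkℚ _ _ _} {mkℚ _ _ _} refl refl = refl

-- In this normal form ℚ-arithmetic on integers computes, which the lemmas below exploit.
ℤtoℚ≡mkℚ : ∀ z → ℤtoℚ z ≡ mkℚ z 0 (Coprimality.sym (Coprimality.1-coprimeTo ℤ.∣ z ∣))
ℤtoℚ≡mkℚ z = ↥↧ₙ-injective ↥≡ (cong ℤ.∣_∣ ↧≡)
  where
  ↥≡ : ↥ (z / 1) ≡ z
  ↥≡ = trans (sym (ℤ.*-identityʳ _)) (trans (cong (↥ (z / 1) ℤ.*_) (sym (ℤ.gcd-zeroʳ z))) (↥-/ z 1))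
  ↧≡ : ↧ (z / 1) ≡ + 1
  ↧≡ = trans (sym (ℤ.*-identityʳ _)) (trans (cong (↧ (z / 1) ℤ.*_) (sym (ℤ.gcd-zeroʳ z))) (↧-/ z 1))

ℤtoℚ-homo-+ : ∀ a b → ℤtoℚ (a ℤ.+ b) ≡ ℤtoℚ a + ℤtoℚ b
ℤtoℚ-homo-+ a b rewrite ℤtoℚ≡mkℚ a | ℤtoℚ≡mkℚ b | ℤ.*-identityʳ a | ℤ.*-identityʳ b = refl

ℤtoℚ-homo-* : ∀ a b → ℤtoℚ (a ℤ.* b) ≡ ℤtoℚ a * ℤtoℚ b
ℤtoℚ-homo-* a b rewrite ℤtoℚ≡mkℚ a | ℤtoℚ≡mkℚ b = refl

ℤtoℚ-homo-neg : ∀ a → ℤtoℚ (ℤ.- a) ≡ - ℤtoℚ a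
ℤtoℚ-homo-neg a rewrite ℤtoℚ≡mkℚ a | ℤtoℚ≡mkℚ (ℤ.- a) =
  ↥↧ₙ-injective (sym (↥-neg (mkℚ a 0 _))) (cong ℤ.∣_∣ (sym (↧-neg (mkℚ a 0 _))))

ℤtoℚ-mono-≤ : ∀ {a b} → a ℤ.≤ b → ℤtoℚ a ≤ ℤtoℚ b
ℤtoℚ-mono-≤ {a} {b} a≤b rewrite ℤtoℚ≡mkℚ a | ℤtoℚ≡mkℚ b = *≤* (ℤ.*-monoʳ-≤-nonNeg (+ 1) a≤b)

ℤtoℚ-mono-< : ∀ {a b} → a ℤ.< b → ℤtoℚ a < ℤtoℚ b
ℤtoℚ-mono-< {a} {b} a<b rewrite ℤtoℚ≡mkℚ a | ℤtoℚ≡mkℚ b =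
  *<* (subst₂ ℤ._<_ (sym (ℤ.*-identityʳ a)) (sym (ℤ.*-identityʳ b)) a<b)

ℤtoℚ-cancel-< : ∀ {a b} → ℤtoℚ a < ℤtoℚ b → a ℤ.< b
ℤtoℚ-cancel-< {a} {b} p rewrite ℤtoℚ≡mkℚ a | ℤtoℚ≡mkℚ b with p
... | *<* a*1<b*1 = subst₂ ℤ._<_ (ℤ.*-identityʳ a) (ℤ.*-identityʳ b) a*1<b*1

i<j+1⇒i≤j : ∀ {i j} → i ℤ.< j ℤ.+ + 1 → i ℤ.≤ j
i<j+1⇒i≤j {i} {j} i<j+1 = ℤ.≮⇒≥ λ j<i →
  ℤ.<-irrefl refl (ℤ.<-≤-trans i<j+1 (subst (ℤ._≤ i) (ℤ.+-comm (+ 1) j) (ℤ.i<j⇒suc[i]≤j j<i)))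

floor≤ : ∀ p → ℤtoℚ (floor p) ≤ p
floor≤ p@(mkℚ a d _) rewrite ℤtoℚ≡mkℚ (a ℤ./ + suc d) =
  *≤* (subst ((a ℤ./ + suc d) ℤ.* + suc d ℤ.≤_) (sym (ℤ.*-identityʳ a)) (ℤ.[n/d]*d≤n a (+ suc d)))

<floor+1 : ∀ p → p < ℤtoℚ (floor p) + 1ℚ
<floor+1 p@(mkℚ a d _) rewrite sym (ℤtoℚ-homo-+ (a ℤ./ + suc d) (+ 1)) | ℤtoℚ≡mkℚ ((a ℤ./ + suc d) ℤ.+ + 1) =
  *<* (subst₂ ℤ._<_ (sym (ℤ.*-identityʳ a))
                   (cong (ℤ._* + suc d) (trans (ℤ.+-comm (+ 1) (a ℤ./ℕ suc d)) (cong (ℤ._+ + 1) (sym (ℤ.div-pos-is-/ℕ a (suc d))))))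
                   (ℤ.n<s[n/ℕd]*d a (suc d)))

floor-unique : ∀ z p → ℤtoℚ z ≤ p → p < ℤtoℚ z + 1ℚ → floor p ≡ z
floor-unique z p z≤p p<z+1 = ℤ.≤-antisym (<+1⇒≤ (≤-<-trans (floor≤ p) p<z+1)) (<+1⇒≤ (≤-<-trans z≤p (<floor+1 p)))
  where
  <+1⇒≤ : ∀ {i j} → ℤtoℚ i < ℤtoℚ j + 1ℚ → i ℤ.≤ j
  <+1⇒≤ {i} {j} i<j+1 = i<j+1⇒i≤j (ℤtoℚ-cancel-< (subst (ℤtoℚ i <_) (sym (ℤtoℚ-homo-+ j (+ 1))) i<j+1))

ceiling-unique : ∀ z p → p ≤ ℤtoℚ z → ℤtoℚ z < p + 1ℚ → ceiling p ≡ z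
ceiling-unique z p@(mkℚ _ _ _) p≤z z<p+1 = trans (cong ℤ.-_ floor[-p]≡-z) (ℤ.neg-involutive z)
  where
  floor[-p]≡-z : floor (- p) ≡ ℤ.- z
  floor[-p]≡-z = floor-unique (ℤ.- z) (- p)
    (subst (_≤ - p) (sym (ℤtoℚ-homo-neg z)) (neg-antimono-≤ p≤z))
    (subst₂ _<_ (solve 1 (λ p → (:- (p :+ con 1ℚ)) :+ con 1ℚ := :- p) refl p)
                (cong (_+ 1ℚ) (sym (ℤtoℚ-homo-neg z)))
                (+-monoˡ-< 1ℚ (neg-antimono-< z<p+1)))

zigzag-ℤtoℚ : ∀ z → zigzag (ℤtoℚ z) ≡ 0ℚ
zigzag-ℤtoℚ z = begin
  (Z - ℤtoℚ (floor Z)) ⊓ (ℤtoℚ (ceiling Z) - Z) ≡⟨ cong₂ (λ a b → (Z - ℤtoℚ a) ⊓ (ℤtoℚ b - Z))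
                                                          (floor-unique z Z ≤-refl Z<Z+1) (ceiling-unique z Z ≤-refl Z<Z+1) ⟩
  (Z - Z) ⊓ (Z - Z)                             ≡⟨ cong₂ _⊓_ (+-inverseʳ Z) (+-inverseʳ Z) ⟩
  0ℚ ⊓ 0ℚ                                       ≡⟨ ⊓-idem 0ℚ ⟩
  0ℚ                                            ∎
  where
  Z = ℤtoℚ z
  Z<Z+1 : Z < Z + 1ℚ
  Z<Z+1 = subst (_< Z + 1ℚ) (+-identityʳ Z) (+-monoʳ-< Z (positive⁻¹ 1ℚ))

zigzag-ℤtoℚ+ : ∀ z {u} → 0ℚ ≤ u → u < 1ℚ → zigzag (ℤtoℚ z + u) ≡ u ⊓ (1ℚ - u)
zigzag-ℤtoℚ+ z {u} 0≤u u<1 with <-cmp 0ℚ u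
... | tri≈ _ refl _ = trans (cong zigzag (+-identityʳ (ℤtoℚ z))) (zigzag-ℤtoℚ z)
... | tri> _ _ u<0 = contradiction (≤-<-trans 0≤u u<0) (<-irrefl refl)
... | tri< 0<u _ _ = begin
  (x - ℤtoℚ (floor x)) ⊓ (ℤtoℚ (ceiling x) - x) ≡⟨ cong₂ (λ a b → (x - ℤtoℚ a) ⊓ (ℤtoℚ b - x)) floor≡ ceiling≡ ⟩
  (x - Z) ⊓ (ℤtoℚ (z ℤ.+ + 1) - x)              ≡⟨ cong (λ w → (x - Z) ⊓ (w - x)) (ℤtoℚ-homo-+ z (+ 1)) ⟩
  (x - Z) ⊓ ((Z + 1ℚ) - x)                      ≡⟨ cong₂ _⊓_ (solve 2 (λ Z u → (Z :+ u) :- Z := u) refl Z u)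
                                                              (solve 2 (λ Z u → (Z :+ con 1ℚ) :- (Z :+ u) := con 1ℚ :- u) refl Z u) ⟩
  u ⊓ (1ℚ - u)                                  ∎
  where
  Z = ℤtoℚ z
  x = Z + u
  Z<x : Z < x
  Z<x = subst (_< x) (+-identityʳ Z) (+-monoʳ-< Z 0<u)
  x<Z+1 : x < Z + 1ℚ
  x<Z+1 = +-monoʳ-< Z u<1
  floor≡ : floor x ≡ z
  floor≡ = floor-unique z x (<⇒≤ Z<x) x<Z+1
  ceiling≡ : ceiling x ≡ z ℤ.+ + 1
  ceiling≡ = ceiling-unique (z ℤ.+ + 1) x
    (subst (x ≤_) (sym (ℤtoℚ-homo-+ z (+ 1))) (<⇒≤ x<Z+1))
    (subst (_< x + 1ℚ) (sym (ℤtoℚ-homo-+ z (+ 1))) (+-monoˡ-< 1ℚ Z<x))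

ℕtoℚ-homo-+ : ∀ a b → ℕtoℚ (a ℕ.+ b) ≡ ℕtoℚ a + ℕtoℚ b
ℕtoℚ-homo-+ a b = trans (cong ℤtoℚ (sym (ℤ.pos-+ a b))) (ℤtoℚ-homo-+ (+ a) (+ b))

ℕtoℚ-homo-* : ∀ a b → ℕtoℚ (a ℕ.* b) ≡ ℕtoℚ a * ℕtoℚ b
ℕtoℚ-homo-* a b = trans (cong ℤtoℚ (ℤ.pos-* a b)) (ℤtoℚ-homo-* (+ a) (+ b))

ℕtoℚ-homo-∸ : ∀ a b → b ℕ.≤ a → ℕtoℚ (a ℕ.∸ b) ≡ ℕtoℚ a - ℕtoℚ b
ℕtoℚ-homo-∸ a b b≤a = begin
  ℕtoℚ (a ℕ.∸ b)                         ≡⟨ solve 2 (λ c b → c := (c :+ b) :- b) refl (ℕtoℚ (a ℕ.∸ b)) (ℕtoℚ b) ⟩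
  (ℕtoℚ (a ℕ.∸ b) + ℕtoℚ b) - ℕtoℚ b     ≡⟨ cong (_- ℕtoℚ b) (sym (ℕtoℚ-homo-+ (a ℕ.∸ b) b)) ⟩
  ℕtoℚ (a ℕ.∸ b ℕ.+ b) - ℕtoℚ b          ≡⟨ cong (λ w → ℕtoℚ w - ℕtoℚ b) (ℕ.m∸n+n≡m b≤a) ⟩
  ℕtoℚ a - ℕtoℚ b                        ∎

ℕtoℚ-mono-≤ : ∀ {a b} → a ℕ.≤ b → ℕtoℚ a ≤ ℕtoℚ b
ℕtoℚ-mono-≤ a≤b = ℤtoℚ-mono-≤ (ℤ.+≤+ a≤b)

ℕtoℚ-mono-< : ∀ {a b} → a ℕ.< b → ℕtoℚ a < ℕtoℚ b
ℕtoℚ-mono-< a<b = ℤtoℚ-mono-< (ℤ.+<+ a<b)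

ℕtoℚ-homo-⊓ : ∀ a b → ℕtoℚ (a ℕ.⊓ b) ≡ ℕtoℚ a ⊓ ℕtoℚ b
ℕtoℚ-homo-⊓ a b with ℕ.≤-total a b
... | inj₁ a≤b = trans (cong ℕtoℚ (ℕ.m≤n⇒m⊓n≡m a≤b)) (sym (p≤q⇒p⊓q≡p (ℕtoℚ-mono-≤ a≤b)))
... | inj₂ b≤a = trans (cong ℕtoℚ (ℕ.m≥n⇒m⊓n≡n b≤a)) (sym (p≥q⇒p⊓q≡q (ℕtoℚ-mono-≤ b≤a)))

module _ (m : ℕ) .{{_ : ℕ.NonZero m}} {h : ℚ} .{{_ : Positive h}} (m*h≡1 : ℕtoℚ m * h ≡ 1ℚ) where

  ℕtoℚ*zigzag≡distToMultiple : ∀ n → ℕtoℚ m * zigzag (ℕtoℚ n * h) ≡ ℕtoℚ (distToMultiple m n)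
  ℕtoℚ*zigzag≡distToMultiple n = begin
    M * zigzag (ℕtoℚ n * h)        ≡⟨ cong (λ w → M * zigzag w) n*h≡q+u ⟩
    M * zigzag (ℤtoℚ (+ q) + u)    ≡⟨ cong (M *_) (zigzag-ℤtoℚ+ (+ q) 0≤u u<1) ⟩
    M * (u ⊓ (1ℚ - u))             ≡⟨ *-distribˡ-⊓-nonNeg M u (1ℚ - u) ⟩
    (M * u) ⊓ (M * (1ℚ - u))       ≡⟨ cong₂ _⊓_ (solve 3 (λ M r h → M :* (r :* h) := r :* (M :* h)) refl M R h)
                                                (solve 3 (λ M r h → M :* (con 1ℚ :- r :* h) := M :- r :* (M :* h)) refl M R h) ⟩
    (R * (M * h)) ⊓ (M - R * (M * h)) ≡⟨ cong (λ w → (R * w) ⊓ (M - R * w)) m*h≡1 ⟩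
    (R * 1ℚ) ⊓ (M - R * 1ℚ)        ≡⟨ cong (λ w → w ⊓ (M - w)) (*-identityʳ R) ⟩
    R ⊓ (M - R)                    ≡⟨ cong (R ⊓_) (sym (ℕtoℚ-homo-∸ m r (ℕ.<⇒≤ r<m))) ⟩
    R ⊓ ℕtoℚ (m ℕ.∸ r)             ≡⟨ sym (ℕtoℚ-homo-⊓ r (m ℕ.∸ r)) ⟩
    ℕtoℚ (distToMultiple m n)      ∎
    where
    M = ℕtoℚ m
    r = n ℕ.% m
    q = n ℕ./ m
    R = ℕtoℚ r
    u = R * h
    r<m : r ℕ.< m
    r<m = ℕ.m%n<n n m
    instance
      M-nonNeg : NonNegative M
      M-nonNeg = normalize-nonNeg m 1
      h-nonNeg : NonNegative h
      h-nonNeg = pos⇒nonNeg h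
    0≤u : 0ℚ ≤ u
    0≤u = subst (_≤ u) (*-zeroˡ h) (*-monoʳ-≤-nonNeg h (ℕtoℚ-mono-≤ {0} {r} ℕ.z≤n))
    u<1 : u < 1ℚ
    u<1 = subst (u <_) m*h≡1 (*-monoˡ-<-pos h (ℕtoℚ-mono-< r<m))
    n*h≡q+u : ℕtoℚ n * h ≡ ℤtoℚ (+ q) + u
    n*h≡q+u = begin
      ℕtoℚ n * h                 ≡⟨ cong (λ w → ℕtoℚ w * h) (ℕ.m≡m%n+[m/n]*n n m) ⟩
      ℕtoℚ (r ℕ.+ q ℕ.* m) * h   ≡⟨ cong (_* h) (trans (ℕtoℚ-homo-+ r (q ℕ.* m)) (cong (λ w → R + w) (ℕtoℚ-homo-* q m))) ⟩
      (R + ℕtoℚ q * M) * h       ≡⟨ solve 4 (λ R Q M h → (R :+ Q :* M) :* h := Q :* (M :* h) :+ R :* h) refl R (ℕtoℚ q) M h ⟩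
      ℕtoℚ q * (M * h) + u       ≡⟨ cong (λ w → ℕtoℚ q * w + u) m*h≡1 ⟩
      ℕtoℚ q * 1ℚ + u            ≡⟨ cong (_+ u) (*-identityʳ (ℕtoℚ q)) ⟩
      ℤtoℚ (+ q) + u             ∎

-- The series F̃ at dyadic points

pow2≡ℕtoℚ[2^] : ∀ j → pow2 j ≡ ℕtoℚ (2 ℕ.^ j)
pow2≡ℕtoℚ[2^] zero    = refl
pow2≡ℕtoℚ[2^] (suc j) = trans (cong (ℕtoℚ 2 *_) (pow2≡ℕtoℚ[2^] j)) (sym (ℕtoℚ-homo-* 2 (2 ℕ.^ j)))

pow2*halfPow≡1 : ∀ j → pow2 j * halfPow j ≡ 1ℚ
pow2*halfPow≡1 zero    = refl
pow2*halfPow≡1 (suc j) = begin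
  (ℕtoℚ 2 * pow2 j) * (½ * halfPow j) ≡⟨ solve 4 (λ t p s h → (t :* p) :* (s :* h) := (t :* s) :* (p :* h))
                                                 refl (ℕtoℚ 2) (pow2 j) ½ (halfPow j) ⟩
  (ℕtoℚ 2 * ½) * (pow2 j * halfPow j) ≡⟨ cong (1ℚ *_) (pow2*halfPow≡1 j) ⟩
  1ℚ * 1ℚ                             ≡⟨ *-identityʳ 1ℚ ⟩
  1ℚ                                  ∎

halfPow-pos : ∀ j → Positive (halfPow j)
halfPow-pos zero    = _
halfPow-pos (suc j) = pos*pos⇒pos ½ (halfPow j) {{halfPow-pos j}}

2*[x*halfPow[1+k]]≡x*halfPow[k] : ∀ x k → ℕtoℚ 2 * (x * halfPow (suc k)) ≡ x * halfPow k
2*[x*halfPow[1+k]]≡x*halfPow[k] x k = begin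
  ℕtoℚ 2 * (x * (½ * halfPow k)) ≡⟨ solve 4 (λ t x s h → t :* (x :* (s :* h)) := (t :* s) :* (x :* h))
                                            refl (ℕtoℚ 2) x ½ (halfPow k) ⟩
  1ℚ * (x * halfPow k)           ≡⟨ *-identityˡ (x * halfPow k) ⟩
  x * halfPow k                  ∎

pow2*zigzag≡dyadicDist : ∀ j n → pow2 j * zigzag (ℕtoℚ n * halfPow j) ≡ ℕtoℚ (dyadicDist j n)
pow2*zigzag≡dyadicDist j n = trans (cong (_* zigzag (ℕtoℚ n * halfPow j)) (pow2≡ℕtoℚ[2^] j))
  (ℕtoℚ*zigzag≡distToMultiple (2 ℕ.^ j) {{ℕ.m^n≢0 2 j}} {{halfPow-pos j}}
     (trans (cong (_* halfPow j) (sym (pow2≡ℕtoℚ[2^] j))) (pow2*halfPow≡1 j)) n)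

Fterm-zero : ∀ x → Fterm x 0 ≡ zigzag x
Fterm-zero x = trans (*-identityˡ _) (cong zigzag (*-identityˡ x))

Fterm-suc : ∀ x i → Fterm x (suc i) ≡ ½ * Fterm (ℕtoℚ 2 * x) i
Fterm-suc x i = begin
  (½ * halfPow i) * zigzag ((ℕtoℚ 2 * pow2 i) * x) ≡⟨ cong (λ w → (½ * halfPow i) * zigzag w)
                                                           (solve 3 (λ t p x → (t :* p) :* x := p :* (t :* x)) refl (ℕtoℚ 2) (pow2 i) x) ⟩
  (½ * halfPow i) * zigzag (pow2 i * (ℕtoℚ 2 * x)) ≡⟨ *-assoc ½ (halfPow i) _ ⟩
  ½ * Fterm (ℕtoℚ 2 * x) i                         ∎

Fpartial-suc : ∀ x N → Fpartial x (suc N) ≡ zigzag x + ½ * Fpartial (ℕtoℚ 2 * x) N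
Fpartial-suc x zero    = trans (+-identityˡ (Fterm x 0)) (trans (Fterm-zero x) (sym (+-identityʳ (zigzag x))))
Fpartial-suc x (suc N) = begin
  Fpartial x (suc N) + Fterm x (suc N)           ≡⟨ cong₂ _+_ (Fpartial-suc x N) (Fterm-suc x N) ⟩
  (zigzag x + ½ * P) + ½ * T                     ≡⟨ solve 4 (λ z h P T → (z :+ h :* P) :+ h :* T := z :+ h :* (P :+ T))
                                                            refl (zigzag x) ½ P T ⟩
  zigzag x + ½ * (P + T)                         ∎
  where
  P = Fpartial (ℕtoℚ 2 * x) N
  T = Fterm (ℕtoℚ 2 * x) N

pow2*Fpartial≡distSum : ∀ k n → pow2 k * Fpartial (ℕtoℚ n * halfPow k) k ≡ ℕtoℚ (distSum n k)
pow2*Fpartial≡distSum zero    n = refl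
pow2*Fpartial≡distSum (suc k) n = begin
  pow2 (suc k) * Fpartial y (suc k)
    ≡⟨ cong (pow2 (suc k) *_) (Fpartial-suc y k) ⟩
  pow2 (suc k) * (zigzag y + ½ * Fpartial (ℕtoℚ 2 * y) k)
    ≡⟨ cong (λ w → pow2 (suc k) * (zigzag y + ½ * Fpartial w k)) (2*[x*halfPow[1+k]]≡x*halfPow[k] (ℕtoℚ n) k) ⟩
  (ℕtoℚ 2 * pow2 k) * (zigzag y + ½ * F)
    ≡⟨ solve 5 (λ t p z s F → (t :* p) :* (z :+ s :* F) := (t :* p) :* z :+ (t :* s) :* (p :* F))
               refl (ℕtoℚ 2) (pow2 k) (zigzag y) ½ F ⟩
  pow2 (suc k) * zigzag y + 1ℚ * (pow2 k * F)
    ≡⟨ cong₂ _+_ (pow2*zigzag≡dyadicDist (suc k) n) (trans (*-identityˡ _) (pow2*Fpartial≡distSum k n)) ⟩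
  ℕtoℚ (dyadicDist (suc k) n) + ℕtoℚ (distSum n k)
    ≡⟨ sym (ℕtoℚ-homo-+ (dyadicDist (suc k) n) (distSum n k)) ⟩
  ℕtoℚ (distSum n (suc k)) ∎
  where
  y = ℕtoℚ n * halfPow (suc k)
  F = Fpartial (ℕtoℚ n * halfPow k) k

Fterm-dyadic-vanishes : ∀ k n t → Fterm (ℕtoℚ n * halfPow k) (k ℕ.+ t) ≡ 0ℚ
Fterm-dyadic-vanishes zero n t = begin
  halfPow t * zigzag (pow2 t * (ℕtoℚ n * 1ℚ)) ≡⟨ cong (λ w → halfPow t * zigzag w) 2^t*n≡ ⟩
  halfPow t * zigzag (ℤtoℚ (+ (2 ℕ.^ t ℕ.* n))) ≡⟨ cong (halfPow t *_) (zigzag-ℤtoℚ (+ (2 ℕ.^ t ℕ.* n))) ⟩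
  halfPow t * 0ℚ                              ≡⟨ *-zeroʳ (halfPow t) ⟩
  0ℚ                                          ∎
  where
  2^t*n≡ : pow2 t * (ℕtoℚ n * 1ℚ) ≡ ℕtoℚ (2 ℕ.^ t ℕ.* n)
  2^t*n≡ = trans (cong₂ _*_ (pow2≡ℕtoℚ[2^] t) (*-identityʳ (ℕtoℚ n))) (sym (ℕtoℚ-homo-* (2 ℕ.^ t) n))
Fterm-dyadic-vanishes (suc k) n t = begin
  Fterm (ℕtoℚ n * halfPow (suc k)) (suc (k ℕ.+ t))
    ≡⟨ Fterm-suc _ (k ℕ.+ t) ⟩
  ½ * Fterm (ℕtoℚ 2 * (ℕtoℚ n * halfPow (suc k))) (k ℕ.+ t)
    ≡⟨ cong (λ w → ½ * Fterm w (k ℕ.+ t)) (2*[x*halfPow[1+k]]≡x*halfPow[k] (ℕtoℚ n) k) ⟩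
  ½ * Fterm (ℕtoℚ n * halfPow k) (k ℕ.+ t)
    ≡⟨ cong (½ *_) (Fterm-dyadic-vanishes k n t) ⟩
  ½ * 0ℚ
    ≡⟨ *-zeroʳ ½ ⟩
  0ℚ ∎

module _ {x : ℚ} {k : ℕ} (vanish : ∀ t → Fterm x (k ℕ.+ t) ≡ 0ℚ) where

  Fpartial-stable : ∀ t → Fpartial x (k ℕ.+ t) ≡ Fpartial x k
  Fpartial-stable zero    = cong (Fpartial x) (ℕ.+-identityʳ k)
  Fpartial-stable (suc t) rewrite ℕ.+-suc k t =
    trans (cong₂ _+_ (Fpartial-stable t) (vanish t)) (+-identityʳ (Fpartial x k))

  FtildeIs-Fpartial : FtildeIs x (Fpartial x k)
  FtildeIs-Fpartial ε ε>0 = k , λ N k≤N → subst (_< ε) (sym (∣Fpartial-Fpartial∣≡0 N k≤N)) ε>0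
    where
    ∣Fpartial-Fpartial∣≡0 : ∀ N → k ℕ.≤ N → ∣ Fpartial x N - Fpartial x k ∣ ≡ 0ℚ
    ∣Fpartial-Fpartial∣≡0 N k≤N = begin
      ∣ Fpartial x N - Fpartial x k ∣               ≡⟨ cong (λ w → ∣ Fpartial x w - Fpartial x k ∣) (sym (ℕ.m+[n∸m]≡n k≤N)) ⟩
      ∣ Fpartial x (k ℕ.+ (N ℕ.∸ k)) - Fpartial x k ∣ ≡⟨ cong (λ w → ∣ w - Fpartial x k ∣) (Fpartial-stable (N ℕ.∸ k)) ⟩
      ∣ Fpartial x k - Fpartial x k ∣               ≡⟨ cong ∣_∣ (+-inverseʳ (Fpartial x k)) ⟩
      0ℚ                                            ∎

corollary4p2 : ∀ (n k : ℕ) → 1 ℕ.≤ n → n ℕ.≤ 2 ℕ.^ k →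
    ∃[ L ] (FtildeIs (ℕtoℚ n * halfPow k) L ×
      ℕtoℚ (B n) ≡ ℕtoℚ (n ℕ.* k) * ½ - (½ * pow2 k) * L)
corollary4p2 n k 1≤n n≤2^k = L , FtildeIs-Fpartial {k = k} (Fterm-dyadic-vanishes k n) , sym (begin
  ℕtoℚ (n ℕ.* k) * ½ - (½ * pow2 k) * L
    ≡⟨ cong₂ (λ a b → ℕtoℚ a * ½ - b) (sym (2*B+distSum≡n*k k n 1≤n n≤2^k)) (*-assoc ½ (pow2 k) L) ⟩
  ℕtoℚ (2 ℕ.* B n ℕ.+ D) * ½ - ½ * (pow2 k * L)
    ≡⟨ cong₂ (λ a b → a * ½ - ½ * b) (trans (ℕtoℚ-homo-+ (2 ℕ.* B n) D) (cong (_+ ℕtoℚ D) (ℕtoℚ-homo-* 2 (B n))))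
                                      (pow2*Fpartial≡distSum k n) ⟩
  (ℕtoℚ 2 * ℕtoℚ (B n) + ℕtoℚ D) * ½ - ½ * ℕtoℚ D
    ≡⟨ solve 4 (λ t b d s → (t :* b :+ d) :* s :- s :* d := b :* (t :* s)) refl (ℕtoℚ 2) (ℕtoℚ (B n)) (ℕtoℚ D) ½ ⟩
  ℕtoℚ (B n) * 1ℚ
    ≡⟨ *-identityʳ (ℕtoℚ (B n)) ⟩
  ℕtoℚ (B n) ∎)
  where
  L = Fpartial (ℕtoℚ n * halfPow k) k
  D = distSum n k
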